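{- Let $(F_n)_{n\ge 0}$ be the Fibonacci sequence, $F_0=0$, $F_1=F_2=1$, $F_{n+2}=F_{n+1}+F_n$, and let $\mu$ be the Möbius function. The set of primes $p$ such that $p$ divides the denominator (in lowest terms) of the rational number $\frac{1}{n}\sum_{d\mid n}\mu\bigl(\tfrac{n}{d}\bigr)F_d$ for some $n\in\mathbb{N}=\{1,2,3,\dots\}$ is infinite. -}

module Defs where

open import Data.Nat as ℕ using (ℕ; zero; suc; _*_)
open import Data.Nat.Divisibility using (_∣_; _∣?_)
open import Data.Nat.Primality using (Prime; prime?)
open import Data.Integer as ℤ using (ℤ; +_)
open import Data.Rational as ℚ using (ℚ)
import Data.List
open Data.List using (List; []; _∷_; filter; map; length; applyUpTo)
open import Data.List.Relation.Unary.All using (All; all?)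
open import Data.Bool using (Bool; true; false; if_then_else_)
open import Relation.Nullary using (does; ¬?)

fib : ℕ → ℕ
fib 0 = 0
fib 1 = 1
fib (suc (suc n)) = fib (suc n) ℕ.+ fib n

oneTo : ℕ → List ℕ
oneTo n = applyUpTo suc n

divisors : ℕ → List ℕ
divisors n = filter (λ d → d ∣? n) (oneTo n)

primeDivisors : ℕ → List ℕ
primeDivisors n = filter prime? (divisors n)

μ : ℕ → ℤ
μ n = if does (all? (λ p → ¬? ((p * p) ∣? n)) (primeDivisors n))
      then ℤ.-1ℤ ℤ.^ length (primeDivisors n)
      else ℤ.0ℤ

mobFibSum : (k : ℕ) → ℤ
mobFibSum k = Data.List.foldr ℤ._+_ ℤ.0ℤ
  (map (λ d → μ (suc k div d) ℤ.* + fib d) (divisors (suc k)))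
  where
  _div_ : ℕ → ℕ → ℕ
  a div zero = 0
  a div suc b = a ℕ./ suc b

-- the rational number (1/n) Σ_{d ∣ n} μ(n/d) F_d, for n = suc k (in lowest terms)
mobFibAvg : (k : ℕ) → ℚ
mobFibAvg k = mobFibSum k ℚ./ suc k

-- For a prime p the only divisors are 1 and p, so the average is (Fₚ − 1)/p, and p divides its
-- denominator as soon as p ∤ Fₚ − 1. In the group semiring ℕ[ℤ/5] the coefficients of (x + x⁻¹)ⁿ at x
-- and x² differ by ±Fₙ, while the binomial theorem gives (x + x⁻¹)ᵖ ≡ xᵖ + x⁻ᵖ (mod p). When p ≡ ±2
-- (mod 5) the right-hand side is x² + x³, whence Fₚ ≡ −1 (mod p), and p ∤ Fₚ − 1 for odd p. Such primes
-- are unbounded: the classes 0, ±1 (the squares mod 5) are closed under multiplication, so the odd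
-- number 2 + 5·(1·3·5⋯(2m − 1)) ≡ 2 (mod 5) has a prime factor ≡ ±2 (mod 5), and that factor is odd
-- and exceeds 2m − 1.
module Submission where

open import Defs
open import Data.Nat using (ℕ; suc; _≤_)
open import Data.Nat.Divisibility using (_∣_)
open import Data.Nat.Primality using (Prime)
open import Data.Rational using (↧ₙ_)
open import Data.Product using (∃-syntax; _×_)

open import Data.Bool using (if_then_else_)
open import Data.Fin using (Fin; _≟_)
open import Data.Fin.Patterns using (0F; 1F; 2F; 3F; 4F)
import Data.Integer as ℤ
import Data.Integer.Properties as ℤ
open import Data.List using ([]; _∷_; _++_; filter; applyUpTo; length)
open import Data.List.Membership.Propositional using (_∈_)
open import Data.List.Properties using (filter-accept; filter-reject; filter-none; filter-++; applyUpTo-∷ʳ)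
open import Data.List.Relation.Unary.All using (All; all?; lookup)
open import Data.List.Relation.Unary.All.Properties using (applyUpTo⁺₁)
open import Data.List.Relation.Unary.Any using (here; there)
open import Data.Nat using (zero; z≤n; s≤s; z<s; _+_; _*_; _∸_; _<_; _/_; _%_; pred; nonTrivial⇒n>1)
open import Data.Nat.Coprimality using (Coprime)
open import Data.Nat.Divisibility
  using (_∣?_; ∣-refl; ∣-trans; 1∣_; ∣⇒≤; ∣1⇒≡1; m∣m*n; n∣m*n; ∣m⇒∣m*n; ∣n⇒∣m*n; ∣m∣n⇒∣m+n; ∣m+n∣m⇒∣n; m%n≡0⇒n∣m)
open import Data.Nat.DivMod using (m≡m%n+[m/n]*n; m%n<n; %-distribˡ-*; %-remove-+ʳ; m/n≤m; n/1≡n; n/n≡1)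
open import Data.Nat.ListAction using (product)
open import Data.Nat.ListAction.Properties using (∈⇒∣product)
open import Data.Nat.Primality
  using (prime?; euclidsLemma; prime⇒irreducible; irreducible[2]; prime[2]; ¬prime[0]; ¬prime[1];
         prime⇒nonZero; prime⇒nonTrivial)
open import Data.Nat.Primality.Factorisation using (factorise; factors; PrimeFactorisation)
open PrimeFactorisation using (isFactorisation; factorsPrime)
open import Data.Nat.Properties
  using (+-identityʳ; *-identityˡ; *-identityʳ; +-comm; +-assoc; +-suc; *-distribˡ-+; *-distribʳ-+;
         +-commutativeSemigroup; ≤-trans; <-irrefl; <⇒≱; ≮⇒≥; _<?_; m≤m+n; m<m+n; m<m*n; m≤n⇒m<n∨m≡n)
open import Algebra.Properties.CommutativeSemigroup +-commutativeSemigroup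
  using (xy∙z≈xz∙y; xy∙z≈x∙zy; x∙yz≈y∙xz) renaming (interchange to +-interchange)
open import Data.Nat.Tactic.RingSolver using (solve-∀)
open import Data.Product using (_,_; proj₁)
import Data.Rational as ℚ
open import Data.Rational.Properties using (normalize-coprime)
open import Data.Sum using (_⊎_; inj₁; inj₂)
open import Function using (_∘_; case_of_)
open import Relation.Binary.PropositionalEquality
open import Relation.Nullary using (¬_; ¬?; does; yes; no; contradiction)
open import Relation.Nullary.Decidable using (dec-false)

-- binom i j = C(i + j, i)
binom : ℕ → ℕ → ℕ
binom zero    j       = 1
binom (suc i) zero    = 1
binom (suc i) (suc j) = binom i (suc j) + binom (suc i) j

binom-zeroʳ : ∀ i → binom i 0 ≡ 1
binom-zeroʳ zero    = refl
binom-zeroʳ (suc i) = refl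

binom-oneˡ : ∀ j → binom 1 j ≡ suc j
binom-oneˡ zero    = refl
binom-oneˡ (suc j) = cong suc (binom-oneˡ j)

binom-absorb : ∀ i j → suc i * binom (suc i) j ≡ (suc i + j) * binom i j
binom-absorb i zero rewrite binom-zeroʳ i = cong (_* 1) (sym (+-identityʳ (suc i)))
binom-absorb zero (suc j) rewrite +-identityʳ (binom 1 (suc j)) | *-identityʳ (suc (suc j)) =
  binom-oneˡ (suc j)
binom-absorb (suc i) (suc j) = begin
  (2 + i) * (b₁₁ + b₂₀)
    ≡⟨ *-distribˡ-+ (2 + i) b₁₁ b₂₀ ⟩
  (b₁₁ + (1 + i) * b₁₁) + (2 + i) * b₂₀
    ≡⟨ cong₂ (λ x y → (b₁₁ + x) + y) (binom-absorb i (suc j)) (binom-absorb (suc i) j) ⟩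
  (b₁₁ + (1 + i + suc j) * b₀₁) + (2 + i + j) * b₁₀
    ≡⟨ rearrange i j b₁₁ b₀₁ b₁₀ ⟩
  b₁₁ + (2 + i + j) * (b₀₁ + b₁₀)
    ≡⟨ cong (_* b₁₁) (+-suc (2 + i) j) ⟨
  (2 + i + suc j) * b₁₁
    ∎
  where
  open ≡-Reasoning
  b₁₁ = binom (suc i) (suc j)
  b₂₀ = binom (suc (suc i)) j
  b₀₁ = binom i (suc j)
  b₁₀ = binom (suc i) j
  rearrange : ∀ i j a b c → (a + (1 + i + suc j) * b) + (2 + i + j) * c ≡ a + (2 + i + j) * (b + c)
  rearrange = solve-∀

prime∣binom : ∀ {p} i j → suc i + suc j ≡ p → Prime p → p ∣ binom (suc i) (suc j)
prime∣binom i j refl p-prime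
  with euclidsLemma (suc i) (binom (suc i) (suc j)) p-prime
         (subst (suc i + suc j ∣_) (sym (binom-absorb i (suc j))) (m∣m*n (binom i (suc j))))
... | inj₁ p∣1+i   = contradiction (∣⇒≤ p∣1+i) (<⇒≱ (m<m+n (suc i) z<s))
... | inj₂ p∣binom = p∣binom

diagSum : ℕ → (ℕ → ℕ → ℕ) → ℕ
diagSum zero    f = f 0 0
diagSum (suc n) f = f 0 (suc n) + diagSum n (λ i j → f (suc i) j)

diagSum-cong : ∀ n {f g} → (∀ i j → f i j ≡ g i j) → diagSum n f ≡ diagSum n g
diagSum-cong zero    f≗g = f≗g 0 0
diagSum-cong (suc n) f≗g = cong₂ _+_ (f≗g 0 (suc n)) (diagSum-cong n (λ i → f≗g (suc i)))

diagSum-+ : ∀ n f g → diagSum n (λ i j → f i j + g i j) ≡ diagSum n f + diagSum n g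
diagSum-+ zero    f g = refl
diagSum-+ (suc n) f g = begin
  (f 0 (suc n) + g 0 (suc n)) + diagSum n (λ i j → f (suc i) j + g (suc i) j)
    ≡⟨ cong ((f 0 (suc n) + g 0 (suc n)) +_) (diagSum-+ n _ _) ⟩
  (f 0 (suc n) + g 0 (suc n)) + (diagSum n (λ i → f (suc i)) + diagSum n (λ i → g (suc i)))
    ≡⟨ +-interchange (f 0 (suc n)) (g 0 (suc n)) _ _ ⟩
  (f 0 (suc n) + diagSum n (λ i → f (suc i))) + (g 0 (suc n) + diagSum n (λ i → g (suc i)))
    ∎
  where open ≡-Reasoning

diagSum-sucʳ : ∀ n f → diagSum (suc n) f ≡ diagSum n (λ i j → f i (suc j)) + f (suc n) 0
diagSum-sucʳ zero    f = refl
diagSum-sucʳ (suc n) f = begin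
  f 0 (2 + n) + diagSum (suc n) (λ i → f (suc i))
    ≡⟨ cong (f 0 (2 + n) +_) (diagSum-sucʳ n (λ i → f (suc i))) ⟩
  f 0 (2 + n) + (diagSum n (λ i j → f (suc i) (suc j)) + f (2 + n) 0)
    ≡⟨ +-assoc (f 0 (2 + n)) (diagSum n (λ i j → f (suc i) (suc j))) (f (2 + n) 0) ⟨
  f 0 (2 + n) + diagSum n (λ i j → f (suc i) (suc j)) + f (2 + n) 0
    ∎
  where open ≡-Reasoning

diagSum-∣ : ∀ {d} n f → (∀ i j → i + j ≡ n → d ∣ f i j) → d ∣ diagSum n f
diagSum-∣ zero    f d∣f = d∣f 0 0 refl
diagSum-∣ (suc n) f d∣f =
  ∣m∣n⇒∣m+n (d∣f 0 (suc n) refl) (diagSum-∣ n _ (λ i j i+j≡n → d∣f (suc i) j (cong suc i+j≡n)))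

binomialSum : ℕ → (ℕ → ℕ → ℕ) → ℕ
binomialSum n h = diagSum n (λ i j → binom i j * h i j)

binomialSum-cong : ∀ n {g h} → (∀ i j → g i j ≡ h i j) → binomialSum n g ≡ binomialSum n h
binomialSum-cong n g≗h = diagSum-cong n (λ i j → cong (binom i j *_) (g≗h i j))

binomialSum-suc : ∀ n h →
  binomialSum (suc n) h ≡ binomialSum n (λ i j → h (suc i) j) + binomialSum n (λ i j → h i (suc j))
binomialSum-suc zero    h = +-comm (1 * h 0 1) (1 * h 1 0)
binomialSum-suc (suc n) h = begin
  1 * h 0 (2 + n) + diagSum (suc n) (λ i j → binom (suc i) j * h (suc i) j)
    ≡⟨ cong (1 * h 0 (2 + n) +_) (diagSum-sucʳ n (λ i j → binom (suc i) j * h (suc i) j)) ⟩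
  1 * h 0 (2 + n) + (diagSum n (λ i j → binom (suc i) (suc j) * h (suc i) (suc j)) + 1 * h (2 + n) 0)
    ≡⟨ cong (λ s → 1 * h 0 (2 + n) + (s + 1 * h (2 + n) 0)) pascal ⟩
  1 * h 0 (2 + n) + ((X + Y) + 1 * h (2 + n) 0)
    ≡⟨ rearrange (1 * h 0 (2 + n)) (1 * h (2 + n) 0) X Y ⟩
  (X + 1 * h (2 + n) 0) + (1 * h 0 (2 + n) + Y)
    ≡⟨ cong (_+ (1 * h 0 (2 + n) + Y)) (diagSum-sucʳ n (λ i j → binom i j * h (suc i) j)) ⟨
  binomialSum (suc n) (λ i j → h (suc i) j) + binomialSum (suc n) (λ i j → h i (suc j))
    ∎
  where
  open ≡-Reasoning
  X = diagSum n (λ i j → binom i (suc j) * h (suc i) (suc j))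
  Y = diagSum n (λ i j → binom (suc i) j * h (suc i) (suc j))
  pascal : diagSum n (λ i j → binom (suc i) (suc j) * h (suc i) (suc j)) ≡ X + Y
  pascal = trans (diagSum-cong n λ i j → *-distribʳ-+ (h (suc i) (suc j)) (binom i (suc j)) (binom (suc i) j))
                 (diagSum-+ n _ _)
  rearrange : ∀ a b x y → a + ((x + y) + b) ≡ (x + b) + (a + y)
  rearrange = solve-∀

binomialSum-prime : ∀ {p} → Prime p → ∀ h → ∃[ M ] (p ∣ M × binomialSum p h ≡ M + (h 0 p + h p 0))
binomialSum-prime {0}           0-prime = contradiction 0-prime ¬prime[0]
binomialSum-prime {1}           1-prime = contradiction 1-prime ¬prime[1]
binomialSum-prime {suc (suc r)} p-prime h = M , diagSum-∣ r _ p∣term , split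
  where
  open ≡-Reasoning
  p = suc (suc r)
  M = diagSum r (λ i j → binom (suc i) (suc j) * h (suc i) (suc j))
  p∣term : ∀ i j → i + j ≡ r → p ∣ binom (suc i) (suc j) * h (suc i) (suc j)
  p∣term i j i+j≡r = ∣m⇒∣m*n _ (prime∣binom i j (cong suc (trans (+-suc i j) (cong suc i+j≡r))) p-prime)
  split : binomialSum p h ≡ M + (h 0 p + h p 0)
  split = begin
    1 * h 0 p + diagSum (suc r) (λ i j → binom (suc i) j * h (suc i) j)
      ≡⟨ cong (1 * h 0 p +_) (diagSum-sucʳ r (λ i j → binom (suc i) j * h (suc i) j)) ⟩
    1 * h 0 p + (M + 1 * h p 0)
      ≡⟨ cong₂ (λ a b → a + (M + b)) (*-identityˡ (h 0 p)) (*-identityˡ (h p 0)) ⟩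
    h 0 p + (M + h p 0)
      ≡⟨ x∙yz≈y∙xz (h 0 p) M (h p 0) ⟩
    M + (h 0 p + h p 0)
      ∎

Z₅ : Set
Z₅ = Fin 5

next neg : Z₅ → Z₅
next 0F = 1F
next 1F = 2F
next 2F = 3F
next 3F = 4F
next 4F = 0F

neg 0F = 0F
neg 1F = 4F
neg 2F = 3F
neg 3F = 2F
neg 4F = 1F

next⁵ : ∀ x → next (next (next (next (next x)))) ≡ x
next⁵ 0F = refl
next⁵ 1F = refl
next⁵ 2F = refl
next⁵ 3F = refl
next⁵ 4F = refl

prev : Z₅ → Z₅
prev = next ∘ next ∘ next ∘ next

neg-neg : ∀ x → neg (neg x) ≡ x
neg-neg 0F = refl
neg-neg 1F = refl
neg-neg 2F = refl
neg-neg 3F = refl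
neg-neg 4F = refl

prev-neg : ∀ x → prev (neg x) ≡ neg (next x)
prev-neg 0F = refl
prev-neg 1F = refl
prev-neg 2F = refl
prev-neg 3F = refl
prev-neg 4F = refl

next-neg : ∀ x → next (neg x) ≡ neg (prev x)
next-neg 0F = refl
next-neg 1F = refl
next-neg 2F = refl
next-neg 3F = refl
next-neg 4F = refl


[_]₅ : ℕ → Z₅
[ zero  ]₅ = 0F
[ suc n ]₅ = next [ n ]₅

[n*5]₅≡0 : ∀ n → [ n * 5 ]₅ ≡ 0F
[n*5]₅≡0 zero    = refl
[n*5]₅≡0 (suc n) = trans (next⁵ [ n * 5 ]₅) ([n*5]₅≡0 n)

[m+n*5]₅≡[m]₅ : ∀ m n → [ m + n * 5 ]₅ ≡ [ m ]₅
[m+n*5]₅≡[m]₅ zero    n = [n*5]₅≡0 n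
[m+n*5]₅≡[m]₅ (suc m) n = cong next ([m+n*5]₅≡[m]₅ m n)

[n]₅≡[n%5]₅ : ∀ n → [ n ]₅ ≡ [ n % 5 ]₅
[n]₅≡[n%5]₅ n = trans (cong [_]₅ (m≡m%n+[m/n]*n n 5)) ([m+n*5]₅≡[m]₅ (n % 5) (n / 5))

diff₅ : ℕ → ℕ → Z₅
diff₅ i zero    = [ i ]₅
diff₅ i (suc j) = prev (diff₅ i j)

diff₅-sucˡ : ∀ i j → diff₅ (suc i) j ≡ next (diff₅ i j)
diff₅-sucˡ i zero    = refl
diff₅-sucˡ i (suc j) = begin
  prev (diff₅ (suc i) j)   ≡⟨ cong prev (diff₅-sucˡ i j) ⟩
  prev (next (diff₅ i j))  ≡⟨ next⁵ (diff₅ i j) ⟩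
  diff₅ i j                ≡⟨ next⁵ (diff₅ i j) ⟨
  next (prev (diff₅ i j))  ∎
  where open ≡-Reasoning

diff₅-zeroˡ : ∀ j → diff₅ 0 j ≡ neg [ j ]₅
diff₅-zeroˡ zero    = refl
diff₅-zeroˡ (suc j) = trans (cong prev (diff₅-zeroˡ j)) (prev-neg [ j ]₅)

δ : Z₅ → Z₅ → ℕ
δ x y = if does (x ≟ y) then 1 else 0

δ-transport : ∀ (σ τ : Z₅ → Z₅) → (∀ x → τ (σ x) ≡ x) → (∀ y → σ (τ y) ≡ y) →
              ∀ x y → δ x (σ y) ≡ δ (τ x) y
δ-transport σ τ τσ στ x y with x ≟ σ y | τ x ≟ y
... | yes _    | yes _    = refl
... | no  _    | no  _    = refl
... | yes x≡σy | no  τx≢y = contradiction (trans (cong τ x≡σy) (τσ y)) τx≢y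
... | no  x≢σy | yes τx≡y = contradiction (trans (sym (στ x)) (cong σ τx≡y)) x≢σy

-- coeff n J is the coefficient of xᴶ in (x + x⁻¹)ⁿ, computed in the group semiring ℕ[ℤ/5]
coeff : ℕ → Z₅ → ℕ
coeff n J = binomialSum n (λ i j → δ J (diff₅ i j))

coeff-suc : ∀ n J → coeff (suc n) J ≡ coeff n (prev J) + coeff n (next J)
coeff-suc n J = trans (binomialSum-suc n (λ i j → δ J (diff₅ i j))) (cong₂ _+_
  (binomialSum-cong n λ i j →
    trans (cong (δ J) (diff₅-sucˡ i j)) (δ-transport next prev next⁵ next⁵ J (diff₅ i j)))
  (binomialSum-cong n λ i j → δ-transport prev next next⁵ next⁵ J (diff₅ i j)))

coeff-neg : ∀ n J → coeff n (neg J) ≡ coeff n J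
coeff-neg zero    J = cong (1 *_) (sym (δ-transport neg neg neg-neg neg-neg J 0F))
coeff-neg (suc n) J = begin
  coeff (suc n) (neg J)
    ≡⟨ coeff-suc n (neg J) ⟩
  coeff n (prev (neg J)) + coeff n (next (neg J))
    ≡⟨ cong₂ _+_ (cong (coeff n) (prev-neg J)) (cong (coeff n) (next-neg J)) ⟩
  coeff n (neg (next J)) + coeff n (neg (prev J))
    ≡⟨ cong₂ _+_ (coeff-neg n (next J)) (coeff-neg n (prev J)) ⟩
  coeff n (next J) + coeff n (prev J)
    ≡⟨ +-comm (coeff n (next J)) (coeff n (prev J)) ⟩
  coeff n (prev J) + coeff n (next J)
    ≡⟨ coeff-suc n J ⟨
  coeff (suc n) J
    ∎
  where open ≡-Reasoning

coeff-prime : ∀ {p} → Prime p → ∀ J → ∃[ M ] (p ∣ M × coeff p J ≡ M + (δ J (neg [ p ]₅) + δ J [ p ]₅))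
coeff-prime {p} p-prime J with binomialSum-prime p-prime (λ i j → δ J (diff₅ i j))
... | M , p∣M , split = M , p∣M , trans split (cong (λ x → M + (δ J x + δ J [ p ]₅)) (diff₅-zeroˡ p))

coeff-suc-0F : ∀ n → coeff (suc n) 0F ≡ coeff n 1F + coeff n 1F
coeff-suc-0F n = trans (coeff-suc n 0F) (cong (_+ coeff n 1F) (coeff-neg n 1F))

coeff-suc-2F : ∀ n → coeff (suc n) 2F ≡ coeff n 1F + coeff n 2F
coeff-suc-2F n = trans (coeff-suc n 2F) (cong (coeff n 1F +_) (coeff-neg n 2F))

-- Over ℤ: coeff n 2F − coeff n 1F = (−1)ⁿ Fₙ and coeff n 0F − coeff n 1F = (−1)ⁿ Fₙ₊₁.
EvenInvariant OddInvariant : ℕ → Set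
EvenInvariant n = coeff n 2F ≡ coeff n 1F + fib n × coeff n 0F ≡ coeff n 1F + fib (suc n)
OddInvariant  n = coeff n 1F ≡ coeff n 2F + fib n × coeff n 1F ≡ coeff n 0F + fib (suc n)

even⇒odd : ∀ n → EvenInvariant n → OddInvariant (suc n)
even⇒odd n (c₂ , c₀) = c₁-c₂ , c₁-c₀
  where
  open ≡-Reasoning
  b  = coeff n 1F
  F₀ = fib n
  F₁ = fib (suc n)
  c₁-c₂ : coeff (suc n) 1F ≡ coeff (suc n) 2F + F₁
  c₁-c₂ = begin
    coeff (suc n) 1F          ≡⟨ coeff-suc n 1F ⟩
    coeff n 0F + coeff n 2F   ≡⟨ cong₂ _+_ c₀ c₂ ⟩
    (b + F₁) + (b + F₀)       ≡⟨ xy∙z≈xz∙y b F₁ (b + F₀) ⟩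
    (b + (b + F₀)) + F₁       ≡⟨ cong (λ c → (b + c) + F₁) c₂ ⟨
    (b + coeff n 2F) + F₁     ≡⟨ cong (_+ F₁) (coeff-suc-2F n) ⟨
    coeff (suc n) 2F + F₁     ∎
  c₁-c₀ : coeff (suc n) 1F ≡ coeff (suc n) 0F + fib (2 + n)
  c₁-c₀ = begin
    coeff (suc n) 1F          ≡⟨ coeff-suc n 1F ⟩
    coeff n 0F + coeff n 2F   ≡⟨ cong₂ _+_ c₀ c₂ ⟩
    (b + F₁) + (b + F₀)       ≡⟨ +-interchange b F₁ b F₀ ⟩
    (b + b) + (F₁ + F₀)       ≡⟨ cong (_+ (F₁ + F₀)) (coeff-suc-0F n) ⟨
    coeff (suc n) 0F + (F₁ + F₀) ∎

odd⇒even : ∀ n → OddInvariant n → EvenInvariant (suc n)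
odd⇒even n (c₁-c₂ , c₁-c₀) = c₂-c₁ , c₀-c₁
  where
  open ≡-Reasoning
  a  = coeff n 0F
  c  = coeff n 2F
  F₀ = fib n
  F₁ = fib (suc n)
  c₂-c₁ : coeff (suc n) 2F ≡ coeff (suc n) 1F + F₁
  c₂-c₁ = begin
    coeff (suc n) 2F          ≡⟨ coeff-suc-2F n ⟩
    coeff n 1F + c            ≡⟨ cong (_+ c) c₁-c₀ ⟩
    (a + F₁) + c              ≡⟨ xy∙z≈xz∙y a F₁ c ⟩
    (a + c) + F₁              ≡⟨ cong (_+ F₁) (coeff-suc n 1F) ⟨
    coeff (suc n) 1F + F₁     ∎
  c₀-c₁ : coeff (suc n) 0F ≡ coeff (suc n) 1F + fib (2 + n)
  c₀-c₁ = begin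
    coeff (suc n) 0F          ≡⟨ coeff-suc-0F n ⟩
    coeff n 1F + coeff n 1F   ≡⟨ cong₂ _+_ c₁-c₀ c₁-c₂ ⟩
    (a + F₁) + (c + F₀)       ≡⟨ +-interchange a F₁ c F₀ ⟩
    (a + c) + (F₁ + F₀)       ≡⟨ cong (_+ (F₁ + F₀)) (coeff-suc n 1F) ⟨
    coeff (suc n) 1F + (F₁ + F₀) ∎

oddInvariant : ∀ k → OddInvariant (suc (k * 2))
oddInvariant zero    = even⇒odd 0 (refl , refl)
oddInvariant (suc k) = even⇒odd (2 + k * 2) (odd⇒even (suc (k * 2)) (oddInvariant k))

odd⇒≡1+[n/2]*2 : ∀ {n} → ¬ 2 ∣ n → n ≡ suc (n / 2 * 2)
odd⇒≡1+[n/2]*2 {n} 2∤n = trans (m≡m%n+[m/n]*n n 2) (cong (_+ n / 2 * 2) n%2≡1)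
  where
  n%2≡1 : n % 2 ≡ 1
  n%2≡1 with n % 2 | m%n<n n 2 | m%n≡0⇒n∣m n 2
  ... | 0 | _ | 2∣n = contradiction (2∣n refl) 2∤n
  ... | 1 | _ | _   = refl
  ... | suc (suc _) | s≤s (s≤s ()) | _

coeff-odd : ∀ {n} → ¬ 2 ∣ n → coeff n 1F ≡ coeff n 2F + fib n
coeff-odd {n} 2∤n =
  subst (λ m → coeff m 1F ≡ coeff m 2F + fib m) (sym (odd⇒≡1+[n/2]*2 2∤n)) (proj₁ (oddInvariant (n / 2)))

SquareMod5 NonSquareMod5 : ℕ → Set
SquareMod5    n = n % 5 ≡ 0 ⊎ n % 5 ≡ 1 ⊎ n % 5 ≡ 4
NonSquareMod5 n = n % 5 ≡ 2 ⊎ n % 5 ≡ 3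

squareMod5⊎nonSquareMod5 : ∀ n → SquareMod5 n ⊎ NonSquareMod5 n
squareMod5⊎nonSquareMod5 n with n % 5 | m%n<n n 5
... | 0 | _ = inj₁ (inj₁ refl)
... | 1 | _ = inj₁ (inj₂ (inj₁ refl))
... | 2 | _ = inj₂ (inj₁ refl)
... | 3 | _ = inj₂ (inj₂ refl)
... | 4 | _ = inj₁ (inj₂ (inj₂ refl))
... | suc (suc (suc (suc (suc _)))) | s≤s (s≤s (s≤s (s≤s (s≤s ()))))

nonSquareMod5⇒¬squareMod5 : ∀ n → NonSquareMod5 n → ¬ SquareMod5 n
nonSquareMod5⇒¬squareMod5 _ (inj₁ ≡2) (inj₁ ≡0)        = case trans (sym ≡2) ≡0 of λ ()
nonSquareMod5⇒¬squareMod5 _ (inj₁ ≡2) (inj₂ (inj₁ ≡1)) = case trans (sym ≡2) ≡1 of λ ()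
nonSquareMod5⇒¬squareMod5 _ (inj₁ ≡2) (inj₂ (inj₂ ≡4)) = case trans (sym ≡2) ≡4 of λ ()
nonSquareMod5⇒¬squareMod5 _ (inj₂ ≡3) (inj₁ ≡0)        = case trans (sym ≡3) ≡0 of λ ()
nonSquareMod5⇒¬squareMod5 _ (inj₂ ≡3) (inj₂ (inj₁ ≡1)) = case trans (sym ≡3) ≡1 of λ ()
nonSquareMod5⇒¬squareMod5 _ (inj₂ ≡3) (inj₂ (inj₂ ≡4)) = case trans (sym ≡3) ≡4 of λ ()

squareMod5-* : ∀ m n → SquareMod5 m → SquareMod5 n → SquareMod5 (m * n)
squareMod5-* m n m-sq n-sq =
  subst (λ r → r ≡ 0 ⊎ r ≡ 1 ⊎ r ≡ 4) (sym (%-distribˡ-* m n 5)) (closed m-sq n-sq)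
  where
  closed : ∀ {a b} → a ≡ 0 ⊎ a ≡ 1 ⊎ a ≡ 4 → b ≡ 0 ⊎ b ≡ 1 ⊎ b ≡ 4 → SquareMod5 (a * b)
  closed (inj₁ refl)        _                  = inj₁ refl
  closed (inj₂ (inj₁ refl)) (inj₁ refl)        = inj₁ refl
  closed (inj₂ (inj₁ refl)) (inj₂ (inj₁ refl)) = inj₂ (inj₁ refl)
  closed (inj₂ (inj₁ refl)) (inj₂ (inj₂ refl)) = inj₂ (inj₂ refl)
  closed (inj₂ (inj₂ refl)) (inj₁ refl)        = inj₁ refl
  closed (inj₂ (inj₂ refl)) (inj₂ (inj₁ refl)) = inj₂ (inj₂ refl)
  closed (inj₂ (inj₂ refl)) (inj₂ (inj₂ refl)) = inj₂ (inj₁ refl)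

nonSquareMod5-factor : ∀ ns → NonSquareMod5 (product ns) → ∃[ q ] (q ∈ ns × NonSquareMod5 q)
nonSquareMod5-factor []       (inj₁ ())
nonSquareMod5-factor []       (inj₂ ())
nonSquareMod5-factor (n ∷ ns) n*ns-nsq
  with squareMod5⊎nonSquareMod5 n | squareMod5⊎nonSquareMod5 (product ns)
... | inj₂ n-nsq | _         = n , here refl , n-nsq
... | inj₁ n-sq  | inj₁ ns-sq =
  contradiction (squareMod5-* n (product ns) n-sq ns-sq) (nonSquareMod5⇒¬squareMod5 (n * product ns) n*ns-nsq)
... | inj₁ _     | inj₂ ns-nsq with nonSquareMod5-factor ns ns-nsq
...   | q , q∈ns , q-nsq = q , there q∈ns , q-nsq

nonSquareMod5⇒[n]₅≡±2 : ∀ n → NonSquareMod5 n → [ n ]₅ ≡ 2F ⊎ [ n ]₅ ≡ 3F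
nonSquareMod5⇒[n]₅≡±2 n (inj₁ n%5≡2) = inj₁ (trans ([n]₅≡[n%5]₅ n) (cong [_]₅ n%5≡2))
nonSquareMod5⇒[n]₅≡±2 n (inj₂ n%5≡3) = inj₂ (trans ([n]₅≡[n%5]₅ n) (cong [_]₅ n%5≡3))

δ-±2 : ∀ {x} → x ≡ 2F ⊎ x ≡ 3F → δ 1F (neg x) + δ 1F x ≡ 0 × δ 2F (neg x) + δ 2F x ≡ 1
δ-±2 (inj₁ refl) = refl , refl
δ-±2 (inj₂ refl) = refl , refl

prime∣fib+1 : ∀ {p} → Prime p → ¬ 2 ∣ p → NonSquareMod5 p → p ∣ fib p + 1
prime∣fib+1 {p} p-prime 2∤p p-nsq
  with coeff-prime p-prime 1F | coeff-prime p-prime 2F | δ-±2 (nonSquareMod5⇒[n]₅≡±2 p p-nsq)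
... | M₁ , p∣M₁ , c₁ | M₂ , p∣M₂ , c₂ | v₁ , v₂ = ∣m+n∣m⇒∣n (subst (p ∣_) M₁≡ p∣M₁) p∣M₂
  where
  open ≡-Reasoning
  x = [ p ]₅
  M₁≡ : M₁ ≡ M₂ + (fib p + 1)
  M₁≡ = begin
    M₁                                     ≡⟨ +-identityʳ M₁ ⟨
    M₁ + 0                                 ≡⟨ cong (M₁ +_) v₁ ⟨
    M₁ + (δ 1F (neg x) + δ 1F x)           ≡⟨ c₁ ⟨
    coeff p 1F                             ≡⟨ coeff-odd 2∤p ⟩
    coeff p 2F + fib p                     ≡⟨ cong (_+ fib p) c₂ ⟩
    (M₂ + (δ 2F (neg x) + δ 2F x)) + fib p ≡⟨ cong (λ v → (M₂ + v) + fib p) v₂ ⟩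
    (M₂ + 1) + fib p                       ≡⟨ xy∙z≈x∙zy M₂ 1 (fib p) ⟩
    M₂ + (fib p + 1)                       ∎

odd-prime∤2 : ∀ {p} → Prime p → ¬ 2 ∣ p → ¬ p ∣ 2
odd-prime∤2 p-prime 2∤p p∣2 with irreducible[2] p∣2
... | inj₁ refl = ¬prime[1] p-prime
... | inj₂ refl = 2∤p ∣-refl

oddProduct : ℕ → ℕ
oddProduct zero    = 1
oddProduct (suc n) = suc (n * 2) * oddProduct n

[1+k*2]∣oddProduct : ∀ {k n} → k < n → suc (k * 2) ∣ oddProduct n
[1+k*2]∣oddProduct {k} {suc n} (s≤s k≤n) with m≤n⇒m<n∨m≡n k≤n
... | inj₁ k<n  = ∣n⇒∣m*n (suc (n * 2)) ([1+k*2]∣oddProduct k<n)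
... | inj₂ refl = m∣m*n (oddProduct n)

2∤1+k*2 : ∀ k → ¬ 2 ∣ suc (k * 2)
2∤1+k*2 k 2∣1+k*2 = case ∣1⇒≡1 (∣m+n∣m⇒∣n (subst (2 ∣_) (+-comm 1 (k * 2)) 2∣1+k*2) (n∣m*n k)) of λ ()

2∤oddProduct : ∀ n → ¬ 2 ∣ oddProduct n
2∤oddProduct zero    = 2∤1+k*2 0
2∤oddProduct (suc n) 2∣product with euclidsLemma (suc (n * 2)) (oddProduct n) prime[2] 2∣product
... | inj₁ 2∣odd   = 2∤1+k*2 n 2∣odd
... | inj₂ 2∣rest  = 2∤oddProduct n 2∣rest

prime∣2+5*oddProduct⇒≥ : ∀ {m q} → Prime q → ¬ 2 ∣ q → q ∣ 2 + 5 * oddProduct m → m ≤ q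
prime∣2+5*oddProduct⇒≥ {m} {q} q-prime 2∤q q∣N with q / 2 <? m
... | no  k≮m = ≤-trans (≮⇒≥ k≮m) (m/n≤m q 2)
... | yes k<m = contradiction q∣2 (odd-prime∤2 q-prime 2∤q)
  where
  q∣oddProduct : q ∣ oddProduct m
  q∣oddProduct = subst (_∣ oddProduct m) (sym (odd⇒≡1+[n/2]*2 2∤q)) ([1+k*2]∣oddProduct k<m)
  q∣2 : q ∣ 2
  q∣2 = ∣m+n∣m⇒∣n (subst (q ∣_) (+-comm 2 (5 * oddProduct m)) q∣N) (∣n⇒∣m*n 5 q∣oddProduct)

large-nonSquareMod5-prime : ∀ m → ∃[ q ] (m ≤ q × Prime q × ¬ 2 ∣ q × NonSquareMod5 q)
large-nonSquareMod5-prime m =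
  large (nonSquareMod5-factor (factors fN) (subst NonSquareMod5 (isFactorisation fN) N-nsq))
  where
  N = 2 + 5 * oddProduct m
  fN = factorise N
  N-nsq : NonSquareMod5 N
  N-nsq = inj₁ (%-remove-+ʳ 2 {d = 5} (m∣m*n (oddProduct m)))
  2∤N : ¬ 2 ∣ N
  2∤N 2∣N with euclidsLemma 5 (oddProduct m) prime[2] (∣m+n∣m⇒∣n 2∣N ∣-refl)
  ... | inj₁ 2∣5       = 2∤1+k*2 2 2∣5
  ... | inj₂ 2∣product = 2∤oddProduct m 2∣product
  large : ∃[ q ] (q ∈ factors fN × NonSquareMod5 q) →
          ∃[ q ] (m ≤ q × Prime q × ¬ 2 ∣ q × NonSquareMod5 q)
  large (q , q∈fN , q-nsq) = q , prime∣2+5*oddProduct⇒≥ q-prime 2∤q q∣N , q-prime , 2∤q , q-nsq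
    where
    q-prime = lookup (factorsPrime fN) q∈fN
    q∣N : q ∣ N
    q∣N = subst (q ∣_) (sym (isFactorisation fN)) (∈⇒∣product q∈fN)
    2∤q : ¬ 2 ∣ q
    2∤q 2∣q = 2∤N (∣-trans 2∣q q∣N)

divisors-prime : ∀ {p} → Prime p → divisors p ≡ 1 ∷ p ∷ []
divisors-prime {0}           0-prime = contradiction 0-prime ¬prime[0]
divisors-prime {1}           1-prime = contradiction 1-prime ¬prime[1]
divisors-prime {suc (suc r)} p-prime = begin
  filter (_∣? p) (1 ∷ proper)
    ≡⟨ filter-accept (_∣? p) (1∣ p) ⟩
  1 ∷ filter (_∣? p) proper
    ≡⟨ cong (λ ds → 1 ∷ filter (_∣? p) ds) (applyUpTo-∷ʳ (suc ∘ suc) r) ⟨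
  1 ∷ filter (_∣? p) (applyUpTo (suc ∘ suc) r ++ p ∷ [])
    ≡⟨ cong (1 ∷_) (filter-++ (_∣? p) (applyUpTo (suc ∘ suc) r) (p ∷ [])) ⟩
  1 ∷ filter (_∣? p) (applyUpTo (suc ∘ suc) r) ++ filter (_∣? p) (p ∷ [])
    ≡⟨ cong₂ (λ ds es → 1 ∷ ds ++ es) (filter-none (_∣? p) no-proper-divisor) (filter-accept (_∣? p) ∣-refl) ⟩
  1 ∷ p ∷ []
    ∎
  where
  open ≡-Reasoning
  p = suc (suc r)
  proper = applyUpTo (suc ∘ suc) (suc r)
  no-proper-divisor : All (λ d → ¬ d ∣ p) (applyUpTo (suc ∘ suc) r)
  no-proper-divisor = applyUpTo⁺₁ (suc ∘ suc) r λ i<r d∣p → case prime⇒irreducible p-prime d∣p of λ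
    { (inj₁ ())
    ; (inj₂ 2+i≡p) → <-irrefl 2+i≡p (s≤s (s≤s i<r)) }

μ-unfold : ∀ n {ps} → primeDivisors n ≡ ps →
  μ n ≡ (if does (all? (λ q → ¬? (q * q ∣? n)) ps) then ℤ.-1ℤ ℤ.^ length ps else ℤ.0ℤ)
μ-unfold n refl = refl

primeDivisors-prime : ∀ {p} → Prime p → primeDivisors p ≡ p ∷ []
primeDivisors-prime {p} p-prime = begin
  filter prime? (divisors p)  ≡⟨ cong (filter prime?) (divisors-prime p-prime) ⟩
  filter prime? (1 ∷ p ∷ [])  ≡⟨ filter-reject prime? {xs = p ∷ []} ¬prime[1] ⟩
  filter prime? (p ∷ [])      ≡⟨ filter-accept prime? {xs = []} p-prime ⟩
  p ∷ []                      ∎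
  where open ≡-Reasoning

prime*prime∤prime : ∀ {p} → Prime p → ¬ p * p ∣ p
prime*prime∤prime {p} p-prime p*p∣p = <⇒≱ (m<m*n p p (nonTrivial⇒n>1 p)) (∣⇒≤ p*p∣p)
  where
  instance
    p-nonZero    = prime⇒nonZero p-prime
    p-nonTrivial = prime⇒nonTrivial p-prime

μ-prime : ∀ {p} → Prime p → μ p ≡ ℤ.-1ℤ
μ-prime {p} p-prime
  rewrite μ-unfold p (primeDivisors-prime p-prime) | dec-false (p * p ∣? p) (prime*prime∤prime p-prime) = refl

fib-pos : ∀ n → 1 ≤ fib (suc n)
fib-pos zero    = s≤s z≤n
fib-pos (suc n) = ≤-trans (fib-pos n) (m≤m+n (fib (suc n)) (fib n))

mobFibSum-prime : ∀ {k} → Prime (suc k) → mobFibSum k ≡ ℤ.+ (fib (suc k) ∸ 1)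
mobFibSum-prime {k} p-prime rewrite divisors-prime p-prime = begin
  μ (suc k / 1) ℤ.* ℤ.+ 1 ℤ.+ (μ (suc k / suc k) ℤ.* ℤ.+ F ℤ.+ ℤ.0ℤ)
    ≡⟨ cong₂ (λ a b → μ a ℤ.* ℤ.+ 1 ℤ.+ (μ b ℤ.* ℤ.+ F ℤ.+ ℤ.0ℤ)) (n/1≡n (suc k)) (n/n≡1 (suc k)) ⟩
  μ (suc k) ℤ.* ℤ.+ 1 ℤ.+ (μ 1 ℤ.* ℤ.+ F ℤ.+ ℤ.0ℤ)
    ≡⟨ cong₂ (λ a b → a ℤ.* ℤ.+ 1 ℤ.+ b) (μ-prime p-prime) (trans (ℤ.+-identityʳ _) (ℤ.*-identityˡ (ℤ.+ F))) ⟩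
  ℤ.-1ℤ ℤ.+ ℤ.+ F
    ≡⟨ -1+F≡F∸1 (fib-pos k) ⟩
  ℤ.+ (F ∸ 1)
    ∎
  where
  open ≡-Reasoning
  F = fib (suc k)
  -1+F≡F∸1 : ∀ {n} → 1 ≤ n → ℤ.-1ℤ ℤ.+ ℤ.+ n ≡ ℤ.+ (n ∸ 1)
  -1+F≡F∸1 (s≤s _) = refl

↧ₙ-coprime : ∀ a d → Coprime a (suc d) → ↧ₙ (ℤ.+ a ℚ./ suc d) ≡ suc d
↧ₙ-coprime a d a⊥d = cong ↧ₙ_ (normalize-coprime a⊥d)

prime∤⇒coprime : ∀ {p a} → Prime p → ¬ p ∣ a → Coprime a p
prime∤⇒coprime p-prime p∤a (d∣a , d∣p) with prime⇒irreducible p-prime d∣p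
... | inj₁ d≡1 = d≡1
... | inj₂ refl = contradiction d∣a p∤a

↧ₙmobFibAvg-prime : ∀ {p} → Prime p → ¬ 2 ∣ p → NonSquareMod5 p → ↧ₙ mobFibAvg (pred p) ≡ p
↧ₙmobFibAvg-prime {0} 0-prime = contradiction 0-prime ¬prime[0]
↧ₙmobFibAvg-prime {suc k} p-prime 2∤p p-nsq = begin
  ↧ₙ (mobFibSum k ℚ./ suc k)          ≡⟨ cong (λ s → ↧ₙ (s ℚ./ suc k)) (mobFibSum-prime p-prime) ⟩
  ↧ₙ (ℤ.+ (F ∸ 1) ℚ./ suc k)          ≡⟨ ↧ₙ-coprime (F ∸ 1) k (prime∤⇒coprime p-prime p∤F∸1) ⟩
  suc k                               ∎
  where
  open ≡-Reasoning
  F = fib (suc k)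
  F+1≡F∸1+2 : ∀ {n} → 1 ≤ n → n + 1 ≡ n ∸ 1 + 2
  F+1≡F∸1+2 {suc n} _ = sym (+-suc n 1)
  p∣F∸1+2 : suc k ∣ F ∸ 1 + 2
  p∣F∸1+2 = subst (suc k ∣_) (F+1≡F∸1+2 (fib-pos k)) (prime∣fib+1 p-prime 2∤p p-nsq)
  p∤F∸1 : ¬ suc k ∣ F ∸ 1
  p∤F∸1 p∣F∸1 = odd-prime∤2 p-prime 2∤p (∣m+n∣m⇒∣n p∣F∸1+2 p∣F∸1)

lemma1p1 : ∀ (m : ℕ) → ∃[ p ] (m ≤ p × Prime p × ∃[ k ] (p ∣ ↧ₙ mobFibAvg k))
lemma1p1 m =
  let (p , m≤p , p-prime , 2∤p , p-nsq) = large-nonSquareMod5-prime m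
  in p , m≤p , p-prime , pred p , subst (p ∣_) (sym (↧ₙmobFibAvg-prime p-prime 2∤p p-nsq)) ∣-refl
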